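{- Let $G$ be a Stopping Game with $n$ nodes. Then there is a numbering of the nodes of $G$ by $1,\dots,n$ (a bijection) in which the two terminal nodes receive the numbers $n-1$ and $n$, and such that every non-terminal node $v$ has an out-arc to a node whose number is greater than the number of $v$.
   Context: A simple stochastic game (SSG) is a finite directed graph $G$ whose nodes are of four types: max, min, average and terminal. There are exactly two terminal nodes, terminal-0 and terminal-1, which have no out-arcs; every max, min and average node has exactly two out-arcs. A max strategy $\sigma$ is a choice of one out-arc at each max node; a min strategy $\tau$ is a choice of one out-arc at each min node. The strategy subgraph $G_{\sigma,\tau}$ is obtained from $G$ by deleting, at each max node, the out-arc not chosen by $\sigma$ and, at each min node, the out-arc not chosen by $\tau$. $G$ is a Stopping Game if for every pair $(\sigma,\tau)$ and every node $v$ there is a directed path in $G_{\sigma,\tau}$ from $v$ to a terminal node. -}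

module Defs where

open import Data.Nat using (ℕ)
open import Data.Fin using (Fin)
open import Data.Bool using (Bool; true; false)
open import Data.Product using (_×_; ∃; _,_)
open import Data.Sum using (_⊎_)
open import Relation.Binary.PropositionalEquality using (_≡_)

data NodeType : Set where
  maxN minN avgN term0 term1 : NodeType

IsTerminal : NodeType → Set
IsTerminal t = (t ≡ term0) ⊎ (t ≡ term1)

-- Every node carries two successor slots 'succ v false' and 'succ v true';
-- for max/min/average nodes these are its two out-arcs, for terminal nodes
-- they are ignored (terminals have no out-arcs).
record SSG (n : ℕ) : Set where
  field
    type : Fin n → NodeType
    succ : Fin n → Bool → Fin n
    t0   : Fin n
    t1   : Fin n
    t0-type : type t0 ≡ term0
    t1-type : type t1 ≡ term1
    t0-unique : ∀ v → type v ≡ term0 → v ≡ t0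
    t1-unique : ∀ v → type v ≡ term1 → v ≡ t1

module _ {n : ℕ} (G : SSG n) where
  open SSG G

  data Arc (v : Fin n) : Fin n → Set where
    arcMax : type v ≡ maxN → (b : Bool) → Arc v (succ v b)
    arcMin : type v ≡ minN → (b : Bool) → Arc v (succ v b)
    arcAvg : type v ≡ avgN → (b : Bool) → Arc v (succ v b)

  -- Strategies: a choice of out-arc (false/true) at each node; the value is
  -- only used at max nodes (for σ) resp. min nodes (for τ).
  Strategy : Set
  Strategy = Fin n → Bool

  data SArc (σ τ : Strategy) (v : Fin n) : Fin n → Set where
    sarcMax : type v ≡ maxN → SArc σ τ v (succ v (σ v))
    sarcMin : type v ≡ minN → SArc σ τ v (succ v (τ v))
    sarcAvg : type v ≡ avgN → (b : Bool) → SArc σ τ v (succ v b)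

  data ReachesTerminal (σ τ : Strategy) : Fin n → Set where
    here : ∀ {v} → IsTerminal (type v) → ReachesTerminal σ τ v
    step : ∀ {v w} → SArc σ τ v w → ReachesTerminal σ τ w → ReachesTerminal σ τ v

  Stopping : Set
  Stopping = ∀ (σ τ : Strategy) (v : Fin n) → ReachesTerminal σ τ v

{-# OPTIONS --safe #-}
-- A node v lies at level k if a terminal is reachable from v along at most k arcs of G, and
-- at no smaller k. Stopping makes every level finite, terminals are exactly the nodes of level 0,
-- and every non-terminal has an out-arc to a node of strictly smaller level. Numbering the nodes
-- in decreasing order of (level, index) therefore gives the two terminals the top numbers and
-- sends every non-terminal along an arc to a higher number.
module Submission where

open import Defs
open import Data.Bool using (true; false)
open import Data.Bool.Properties using (T-≡)
open import Data.Fin as Fin using (Fin; toℕ; fromℕ<; opposite; punchOut)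
open import Data.Fin.Properties
  using (toℕ-injective; toℕ-fromℕ<; <⇒≢; toℕ<n; nonZeroIndex; any?; punchOut-injective; injective⇒≤;
         opposite-prop; opposite-involutive)
open import Data.Fin.Subset using (Subset; _∈_; _⊂_; ∣_∣; ⊤; ⊥; ⁅_⁆)
open import Data.Fin.Subset.Properties
  using (p⊂q⇒∣p∣<∣q∣; ⊆-antisym; ∣⊤∣≡n; ∈⊤; ∉⊥; ∣⊥∣≡0; ∣⁅x⁆∣≡1; x∈⁅y⁆⇔x≡y)
open import Data.Nat using (ℕ; zero; suc; _∸_; _<_; _≤_; _+_; _*_; _%_; _<ᵇ_; z≤n; s≤s)
open import Data.Nat.DivMod using ([m+kn]%n≡m%n; m<n⇒m%n≡m)
open import Data.Nat.Properties
  using (<-irrefl; <-asym; <-trans; <-cmp; ≤-trans; 1+n≰n; n≤0⇒n≡0; <⇒<ᵇ; <ᵇ⇒<;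
         +-identityʳ; +-monoˡ-<; *-monoˡ-≤; m≤n+m; ∸-monoʳ-<; module ≤-Reasoning)
open import Data.Product as Product using (Σ; _×_; ∃; ∃-syntax; _,_; proj₁; proj₂)
open import Data.Sum as Sum using (_⊎_; inj₁; inj₂)
open import Data.Vec using (tabulate)
open import Data.Vec.Properties using (lookup∘tabulate; []=⇒lookup; lookup⇒[]=)
open import Function using (_∘_)
open import Function.Bundles using (_⤖_; Bijection; _⇔_; mk⤖; mk⇔; Equivalence)
open import Function.Definitions using (Injective; Surjective)
open import Relation.Binary using (tri<; tri≈; tri>)
open import Relation.Binary.PropositionalEquality
  using (_≡_; _≢_; refl; sym; trans; cong; subst; subst₂; module ≡-Reasoning)
open import Relation.Nullary using (¬_; Dec; yes; no; contradiction)
open import Relation.Nullary.Decidable using (_⊎-dec_)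
open import Relation.Unary using (Pred; Decidable)

injective⇒surjective : ∀ {n} {f : Fin n → Fin n} → Injective _≡_ _≡_ f → Surjective _≡_ _≡_ f
injective⇒surjective {suc m} {f} f-injective y with any? (λ x → f x Fin.≟ y)
... | yes (x , fx≡y) = x , λ { refl → fx≡y }
... | no y∉image = contradiction (injective⇒≤ g-injective) 1+n≰n
  where
  y≢f : ∀ x → y ≢ f x
  y≢f x y≡fx = y∉image (x , sym y≡fx)

  g : Fin (suc m) → Fin m
  g x = punchOut (y≢f x)

  g-injective : Injective _≡_ _≡_ g
  g-injective {x} {z} = f-injective ∘ punchOut-injective (y≢f x) (y≢f z)

opposite-injective : ∀ {n} → Injective _≡_ _≡_ (opposite {n})
opposite-injective {x = i} {y = j} eq = begin
  i                     ≡⟨ opposite-involutive i ⟨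
  opposite (opposite i) ≡⟨ cong opposite eq ⟩
  opposite (opposite j) ≡⟨ opposite-involutive j ⟩
  j                     ∎
  where open ≡-Reasoning

opposite-reverses-< : ∀ {n} {i j : Fin n} → i Fin.< j → opposite j Fin.< opposite i
opposite-reverses-< {i = i} {j} i<j
  rewrite opposite-prop i | opposite-prop j = ∸-monoʳ-< (s≤s i<j) (toℕ<n j)

least-witness : ∀ {p} {P : Pred ℕ p} → Decidable P → ∀ {k} → P k →
  ∃ λ m → P m × (∀ {j} → P j → m ≤ j)
least-witness P? {zero} Pk = zero , Pk , λ _ → z≤n
least-witness P? {suc k} Pk with P? zero
... | yes P0 = zero , P0 , λ _ → z≤n
... | no ¬P0 with least-witness (P? ∘ suc) Pk
...   | m , Pm , least = suc m , Pm , λ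
  { {zero}  P0 → contradiction P0 ¬P0
  ; {suc j} Pj → s≤s (least Pj)
  }

module Ranking {n : ℕ} (key : Fin n → ℕ) (key-injective : Injective _≡_ _≡_ key) where

  below : Fin n → Subset n
  below v = tabulate (λ u → key u <ᵇ key v)

  ∈-below⁺ : ∀ {u v} → key u < key v → u ∈ below v
  ∈-below⁺ {u} u<v =
    lookup⇒[]= u _ (trans (lookup∘tabulate _ u) (Equivalence.to T-≡ (<⇒<ᵇ u<v)))

  ∈-below⁻ : ∀ {u v} → u ∈ below v → key u < key v
  ∈-below⁻ {u} u∈ =
    <ᵇ⇒< _ _ (Equivalence.from T-≡ (trans (sym (lookup∘tabulate _ u)) ([]=⇒lookup u∈)))

  ∉-below-self : ∀ v → ¬ v ∈ below v
  ∉-below-self v v∈ = <-irrefl refl (∈-below⁻ v∈)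

  ∣below∣<n : ∀ v → ∣ below v ∣ < n
  ∣below∣<n v = subst (∣ below v ∣ <_) (∣⊤∣≡n n)
    (p⊂q⇒∣p∣<∣q∣ ((λ _ → ∈⊤) , v , ∈⊤ , ∉-below-self v))

  below-⊂ : ∀ {u v} → key u < key v → below u ⊂ below v
  below-⊂ {u} u<v =
    ∈-below⁺ ∘ (λ w<u → <-trans w<u u<v) ∘ ∈-below⁻ , u , ∈-below⁺ u<v , ∉-below-self u

  below-≡ : ∀ {v} (p : Subset n) → (∀ {u} → u ∈ p ⇔ key u < key v) → below v ≡ p
  below-≡ p p≡below =
    ⊆-antisym (Equivalence.from p≡below ∘ ∈-below⁻) (∈-below⁺ ∘ Equivalence.to p≡below)

  rank : Fin n → Fin n
  rank v = fromℕ< (∣below∣<n v)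

  toℕ-rank : ∀ v → toℕ (rank v) ≡ ∣ below v ∣
  toℕ-rank v = toℕ-fromℕ< (∣below∣<n v)

  rank-< : ∀ {u v} → key u < key v → rank u Fin.< rank v
  rank-< {u} {v} u<v rewrite toℕ-rank u | toℕ-rank v = p⊂q⇒∣p∣<∣q∣ (below-⊂ u<v)

  rank-injective : Injective _≡_ _≡_ rank
  rank-injective {u} {v} eq with <-cmp (key u) (key v)
  ... | tri< u<v _ _ = contradiction eq (<⇒≢ (rank-< u<v))
  ... | tri≈ _ u≡v _ = key-injective u≡v
  ... | tri> _ _ v<u = contradiction (sym eq) (<⇒≢ (rank-< v<u))

  number : Fin n → Fin n
  number = opposite ∘ rank

  number-bijection : Fin n ⤖ Fin n
  number-bijection = mk⤖ (number-injective , injective⇒surjective number-injective)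
    where
    number-injective : Injective _≡_ _≡_ number
    number-injective = rank-injective ∘ opposite-injective

  number-reverses-< : ∀ {u v} → key u < key v → number v Fin.< number u
  number-reverses-< = opposite-reverses-< ∘ rank-<

  toℕ-number : ∀ {v} (p : Subset n) → (∀ {u} → u ∈ p ⇔ key u < key v) →
    toℕ (number v) ≡ n ∸ suc ∣ p ∣
  toℕ-number {v} p p≡below = begin
    toℕ (opposite (rank v)) ≡⟨ opposite-prop (rank v) ⟩
    n ∸ suc (toℕ (rank v))  ≡⟨ cong (λ r → n ∸ suc r) (toℕ-rank v) ⟩
    n ∸ suc ∣ below v ∣     ≡⟨ cong (λ q → n ∸ suc ∣ q ∣) (below-≡ p p≡below) ⟩
    n ∸ suc ∣ p ∣           ∎
    where open ≡-Reasoning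

isTerminal? : ∀ t → Dec (IsTerminal t)
isTerminal? term0 = yes (inj₁ refl)
isTerminal? term1 = yes (inj₂ refl)
isTerminal? maxN  = no λ { (inj₁ ()) ; (inj₂ ()) }
isTerminal? minN  = no λ { (inj₁ ()) ; (inj₂ ()) }
isTerminal? avgN  = no λ { (inj₁ ()) ; (inj₂ ()) }

module _ {n : ℕ} (G : SSG n) where
  open SSG G

  ReachesTerminalWithin : ℕ → Fin n → Set
  ReachesTerminalWithin zero    v = IsTerminal (type v)
  ReachesTerminalWithin (suc k) v =
    IsTerminal (type v)
      ⊎ ReachesTerminalWithin k (succ v false)
      ⊎ ReachesTerminalWithin k (succ v true)

  reachesTerminalWithin? : ∀ k v → Dec (ReachesTerminalWithin k v)
  reachesTerminalWithin? zero    v = isTerminal? (type v)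
  reachesTerminalWithin? (suc k) v =
    isTerminal? (type v)
      ⊎-dec reachesTerminalWithin? k (succ v false)
      ⊎-dec reachesTerminalWithin? k (succ v true)

  via-successor : ∀ {k v} b → ReachesTerminalWithin k (succ v b) → ReachesTerminalWithin (suc k) v
  via-successor false = inj₂ ∘ inj₁
  via-successor true  = inj₂ ∘ inj₂

  via-strategy-arc : ∀ {σ τ k v w} → SArc G σ τ v w →
    ReachesTerminalWithin k w → ReachesTerminalWithin (suc k) v
  via-strategy-arc {σ}     {v = v} (sarcMax _)   = via-successor (σ v)
  via-strategy-arc {τ = τ} {v = v} (sarcMin _)   = via-successor (τ v)
  via-strategy-arc                 (sarcAvg _ b) = via-successor b

  reachesTerminal⇒within : ∀ {σ τ v} → ReachesTerminal G σ τ v → ∃ λ k → ReachesTerminalWithin k v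
  reachesTerminal⇒within (here t)   = 0 , t
  reachesTerminal⇒within (step a r) = Product.map suc (via-strategy-arc a) (reachesTerminal⇒within r)

  nonterminal-arc : ∀ v → ¬ IsTerminal (type v) → ∀ b → Arc G v (succ v b)
  nonterminal-arc v ¬t b with type v in eq
  ... | maxN  = arcMax eq b
  ... | minN  = arcMin eq b
  ... | avgN  = arcAvg eq b
  ... | term0 = contradiction (inj₁ refl) ¬t
  ... | term1 = contradiction (inj₂ refl) ¬t

  t0≢t1 : t0 ≢ t1
  t0≢t1 eq with trans (sym t0-type) (trans (cong type eq) t1-type)
  ... | ()

  terminal-cases : ∀ v → IsTerminal (type v) → v ≡ t0 ⊎ v ≡ t1
  terminal-cases v = Sum.map (t0-unique v) (t1-unique v)

  module Levels (stopping : Stopping G) where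

    private
      -- Any strategy pair would do: a path in G_{σ,τ} is a path in G.
      least-level : ∀ v →
        ∃ λ m → ReachesTerminalWithin m v × (∀ {j} → ReachesTerminalWithin j v → m ≤ j)
      least-level v = least-witness (λ k → reachesTerminalWithin? k v)
        (proj₂ (reachesTerminal⇒within (stopping (λ _ → false) (λ _ → false) v)))

    level : Fin n → ℕ
    level v = proj₁ (least-level v)

    level-minimal : ∀ {k v} → ReachesTerminalWithin k v → level v ≤ k
    level-minimal {v = v} = proj₂ (proj₂ (least-level v))

    level-terminal : ∀ {v} → IsTerminal (type v) → level v ≡ 0
    level-terminal = n≤0⇒n≡0 ∘ level-minimal {0}

    level-descent : ∀ v → ¬ IsTerminal (type v) → ∃ λ b → level (succ v b) < level v
    level-descent v ¬t = descend (proj₁ (proj₂ (least-level v)))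
      where
      descend : ∀ {k} → ReachesTerminalWithin k v → ∃ λ b → level (succ v b) < k
      descend {zero}  t                = contradiction t ¬t
      descend {suc k} (inj₁ t)         = contradiction t ¬t
      descend {suc k} (inj₂ (inj₁ r)) = false , s≤s (level-minimal r)
      descend {suc k} (inj₂ (inj₂ r)) = true  , s≤s (level-minimal r)

    level-nonterminal : ∀ {v} → ¬ IsTerminal (type v) → 0 < level v
    level-nonterminal {v} ¬t = ≤-trans (s≤s z≤n) (proj₂ (level-descent v ¬t))

    -- Lexicographic in (level, index), since indices are below n.
    key : Fin n → ℕ
    key v = toℕ v + level v * n

    key-injective : Injective _≡_ _≡_ key
    key-injective {u} {v} eq = toℕ-injective (begin
      toℕ u         ≡⟨ key%n u ⟨
      key u % n     ≡⟨ cong (_% n) eq ⟩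
      key v % n     ≡⟨ key%n v ⟩
      toℕ v         ∎)
      where
      open ≡-Reasoning
      instance _ = nonZeroIndex u
      key%n : ∀ w → key w % n ≡ toℕ w
      key%n w = trans ([m+kn]%n≡m%n (toℕ w) (level w) n) (m<n⇒m%n≡m (toℕ<n w))

    key-<-level : ∀ {u v} → level u < level v → key u < key v
    key-<-level {u} {v} lu<lv = begin-strict
      toℕ u + level u * n  <⟨ +-monoˡ-< (level u * n) (toℕ<n u) ⟩
      suc (level u) * n    ≤⟨ *-monoˡ-≤ n lu<lv ⟩
      level v * n          ≤⟨ m≤n+m (level v * n) (toℕ v) ⟩
      key v                ∎
      where open ≤-Reasoning

    key-terminal : ∀ {v} → IsTerminal (type v) → key v ≡ toℕ v
    key-terminal {v} t rewrite level-terminal t = +-identityʳ (toℕ v)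

    terminal-key-< : ∀ {t u} → IsTerminal (type t) → ¬ IsTerminal (type u) → key t < key u
    terminal-key-< {u = u} t ¬tu =
      key-<-level (subst (_< level u) (sym (level-terminal t)) (level-nonterminal ¬tu))

    below-terminal : ∀ {u t} → IsTerminal (type t) → key u < key t →
      IsTerminal (type u) × toℕ u < toℕ t
    below-terminal {u} t u<t with isTerminal? (type u)
    ... | yes tu = tu , subst₂ _<_ (key-terminal tu) (key-terminal t) u<t
    ... | no ¬tu = contradiction u<t (<-asym (terminal-key-< t ¬tu))

    open Ranking key key-injective public

    terminal-numbers : ∀ {a b} → (∀ v → IsTerminal (type v) → v ≡ a ⊎ v ≡ b) →
      IsTerminal (type a) → IsTerminal (type b) → toℕ a < toℕ b →
      toℕ (number a) ≡ n ∸ 1 × toℕ (number b) ≡ n ∸ 2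
    terminal-numbers {a} {b} cases ta tb a<b =
        trans (toℕ-number ⊥ nothing-below-a) (cong (λ s → n ∸ suc s) (∣⊥∣≡0 n))
      , trans (toℕ-number ⁅ a ⁆ only-a-below-b) (cong (λ s → n ∸ suc s) (∣⁅x⁆∣≡1 a))
      where
      nothing-below-a : ∀ {u} → u ∈ ⊥ ⇔ key u < key a
      nothing-below-a = mk⇔ (λ u∈⊥ → contradiction u∈⊥ ∉⊥) (λ u<a → contradiction u<a ≮a)
        where
        ≮a : ∀ {u} → ¬ key u < key a
        ≮a u<a with below-terminal ta u<a
        ... | tu , u<a′ with cases _ tu
        ...   | inj₁ refl = <-irrefl refl u<a′
        ...   | inj₂ refl = <-asym a<b u<a′

      only-a-below-b : ∀ {u} → u ∈ ⁅ a ⁆ ⇔ key u < key b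
      only-a-below-b {u} =
        mk⇔ (a-below-b ∘ Equivalence.to x∈⁅y⁆⇔x≡y) (Equivalence.from x∈⁅y⁆⇔x≡y ∘ is-a)
        where
        a-below-b : u ≡ a → key u < key b
        a-below-b refl = subst₂ _<_ (sym (key-terminal ta)) (sym (key-terminal tb)) a<b
        is-a : key u < key b → u ≡ a
        is-a u<b with below-terminal tb u<b
        ... | tu , u<b′ with cases u tu
        ...   | inj₁ u≡a = u≡a
        ...   | inj₂ refl = contradiction u<b′ (<-irrefl refl)

lemma3 : ∀ {n : ℕ} (G : SSG n) → Stopping G →
    Σ (Fin n ⤖ Fin n) λ f → (let num = λ v → toℕ (Bijection.to f v) in
      (((num (SSG.t0 G) ≡ n ∸ 2) × (num (SSG.t1 G) ≡ n ∸ 1))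
        ⊎ ((num (SSG.t0 G) ≡ n ∸ 1) × (num (SSG.t1 G) ≡ n ∸ 2)))
      × (∀ v → ¬ IsTerminal (SSG.type G v) → ∃[ w ] (Arc G v w × num v < num w)))
lemma3 {n} G stopping = number-bijection , terminals , arcs-upward
  where
  open SSG G
  open Levels G stopping

  t0-terminal : IsTerminal (type t0)
  t0-terminal = inj₁ t0-type

  t1-terminal : IsTerminal (type t1)
  t1-terminal = inj₂ t1-type

  terminals : (toℕ (number t0) ≡ n ∸ 2 × toℕ (number t1) ≡ n ∸ 1)
            ⊎ (toℕ (number t0) ≡ n ∸ 1 × toℕ (number t1) ≡ n ∸ 2)
  terminals with <-cmp (toℕ t0) (toℕ t1)
  ... | tri< t0<t1 _ _ = inj₂ (terminal-numbers (terminal-cases G) t0-terminal t1-terminal t0<t1)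
  ... | tri≈ _ t0≡t1 _ = contradiction (toℕ-injective t0≡t1) (t0≢t1 G)
  ... | tri> _ _ t1<t0 = inj₁ (Product.swap
          (terminal-numbers (λ v → Sum.swap ∘ terminal-cases G v) t1-terminal t0-terminal t1<t0))

  arcs-upward : ∀ v → ¬ IsTerminal (type v) → ∃[ w ] (Arc G v w × toℕ (number v) < toℕ (number w))
  arcs-upward v ¬t with level-descent v ¬t
  ... | b , descent = succ v b , nonterminal-arc G v ¬t b , number-reverses-< (key-<-level descent)
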